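{- Let $T$ be a tree with root (start vertex) $v_s$ and non-negative vertex and edge weights. Let $C=T(b_{l_1},\dots,b_{l_m})$ be a collected subtree of $T$ whose dominating edge $e$ has the greatest weight among all edges that dominate a collected subtree. Let $S$ be an optimal deployment strategy (single group, minimum number of agents) that visits some vertex $v_t$ last, where $v_t$ is not a vertex of $C$. Then $S$ can be reorganized, without increasing the number of agents, into a strategy that first walks from $v_s$ to the root of $C$, visits and fully explores $C$ in any order, and then leaves $C$ (via $e$), and afterwards proceeds (never re-entering $C$ usefully) so that it still ends at $v_t$.
   Context: Strategic deployment problem: A tree $T=(V,E)$ has non-negative vertex weights $w_v$ and edge weights $w_e$ and start vertex $v_s$. Agents start at $v_s$ and (by convention) all non-settled agents move as a single group along a walk starting at $v_s$. When a vertex $v$ is reached for the first time, $w_v$ of the agents present must be left there permanently (settled); an edge $e$ may only be traversed if the group has at least $w_e$ agents. A strategy is valid if all vertices get filled; an optimal strategy uses the minimum number of agents. Collected subtrees: for each leaf $b$ of $T$, let $e(b)$ be the edge of maximal weight on the path from $v_s$ to $b$, choosing among edges of equal maximal weight the one closest to $v_s$; $e(b)$ dominates $b$; let $v(b)$ be the endpoint of $e(b)$ farther from $v_s$, and $T_b$ the path from $v(b)$ to $b$. For leaves $b_{l_1},\dots,b_{l_m}$ dominated by the same edge $e$, the union of the paths $T_{b_{l_1}},\dots,T_{b_{l_m}}$ is the collected subtree $T(b_{l_1},\dots,b_{l_m})$, with root $v(b_{l_1})$ and dominating edge $e$. -}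

module Defs where

open import Data.Nat using (ℕ; zero; suc; _≤_; _∸_)
open import Data.Fin using (Fin; toℕ; _≟_)
import Data.Fin as F
open import Data.Bool using (Bool; true; false; if_then_else_)
open import Data.List using (List; []; _∷_)
open import Data.List.Membership.Propositional using (_∈_)
open import Data.List.Relation.Unary.All using (All)
open import Data.List.Relation.Unary.Unique.Propositional using (Unique)
open import Data.Product using (Σ; ∃; _×_; _,_)
open import Data.Unit using (⊤)
open import Relation.Nullary using (¬_)
open import Relation.Nullary.Decidable using (⌊_⌋)
open import Relation.Binary.PropositionalEquality using (_≡_; _≢_)

-- The root (start vertex v_s) is F.zero.  For i : Fin n, the vertex F.suc i
-- has parent  par i, whose label is strictly smaller (so the graph is a tree,
-- and every rooted tree admits such a labelling, e.g. in BFS order).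
-- Edges are indexed by Fin n: edge i joins F.suc i (farther from v_s) and par i.
-- Weights are natural numbers (they count agents).
record Tree (n : ℕ) : Set where
  field
    par  : Fin n → Fin (suc n)
    par< : ∀ i → toℕ (par i) ≤ toℕ i
    vw   : Fin (suc n) → ℕ
    ew   : Fin n → ℕ

module _ {n : ℕ} (T : Tree n) where
  open Tree T

  V : Set
  V = Fin (suc n)

  vs : V
  vs = F.zero

  data Adj : V → V → Set where
    up   : ∀ i → Adj (F.suc i) (par i)
    down : ∀ i → Adj (par i) (F.suc i)

  edgeOf : ∀ {u v} → Adj u v → Fin n
  edgeOf (up i)   = i
  edgeOf (down i) = i

  data Walk : V → V → Set where
    stop : ∀ {u} → Walk u u
    step : ∀ {u v w} → Adj u v → Walk v w → Walk u w

  infixr 5 _++ʷ_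
  _++ʷ_ : ∀ {u v w} → Walk u v → Walk v w → Walk u w
  stop     ++ʷ W' = W'
  step a W ++ʷ W' = step a (W ++ʷ W')

  verts : ∀ {u w} → Walk u w → List V
  verts {u} stop       = u ∷ []
  verts {u} (step a W) = u ∷ verts W

  IsPath : ∀ {u w} → Walk u w → Set
  IsPath W = Unique (verts W)

  -- deployment semantics: the set of filled vertices is a Bool-valued function
  mark : V → (V → Bool) → (V → Bool)
  mark v vis x = if ⌊ x ≟ v ⌋ then true else vis x

  -- Feasible g vis W : the group of g agents standing at the start of W,
  -- with the vertices in vis already filled, can execute W: every traversed
  -- edge e needs ≥ w_e agents in the group; on first arrival at v, w_v agents
  -- must be present and are settled there.
  Feasible : ∀ {u w} → ℕ → (V → Bool) → Walk u w → Set
  Feasible g vis stop = ⊤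
  Feasible g vis (step {v = v} a W) =
    ew (edgeOf a) ≤ g ×
    (if vis v then Feasible g vis W
     else (vw v ≤ g × Feasible (g ∸ vw v) (mark v vis) W))

  filledAfter : ∀ {u w} → (V → Bool) → Walk u w → (V → Bool)
  filledAfter vis stop = vis
  filledAfter vis (step {v = v} a W) =
    filledAfter (if vis v then vis else mark v vis) W

  noneFilled : V → Bool
  noneFilled _ = false

  -- A strategy = number of agents k + walk starting at v_s.  It is valid if
  -- it can be executed (v_s is filled at the start) and fills all vertices.
  Valid : ∀ {w} → ℕ → Walk vs w → Set
  Valid k W =
    vw vs ≤ k ×
    Feasible (k ∸ vw vs) (mark vs noneFilled) W ×
    (∀ x → filledAfter (mark vs noneFilled) W x ≡ true)

  Optimal : ∀ {w} → ℕ → Walk vs w → Set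
  Optimal k W = Valid k W × (∀ k' {w'} (W' : Walk vs w') → Valid k' W' → k ≤ k')

  data _≼_ : V → V → Set where
    ≼-refl : ∀ {u} → u ≼ u
    ≼-step : ∀ {u} i → u ≼ par i → u ≼ F.suc i

  IsLeaf : V → Set
  IsLeaf b = b ≢ vs × (∀ i → par i ≢ b)

  Dominates : Fin n → V → Set
  Dominates i b =
    IsLeaf b ×
    F.suc i ≼ b ×
    (∀ j → F.suc j ≼ b → ew j ≤ ew i) ×
    (∀ j → F.suc j ≼ b → ew j ≡ ew i → F.suc i ≼ F.suc j)

  -- edge i dominates some collected subtree (i.e. dominates some leaf)
  DominatesCollected : Fin n → Set
  DominatesCollected i = ∃ λ b → Dominates i b

  -- vertices of the collected subtree dominated by edge i: the union of the
  -- paths T_b from v(b) = F.suc i to b over all leaves b dominated by i.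
  -- Its root is F.suc i.
  InC : Fin n → V → Set
  InC i v = ∃ λ b → Dominates i b × F.suc i ≼ v × v ≼ b

  Explores : (i : Fin n) → Walk (F.suc i) (F.suc i) → Set
  Explores i X = All (InC i) (verts X) × (∀ x → InC i x → x ∈ verts X)

-- Since i is the heaviest dominating edge, every edge of T weighs at most w(i), and the
-- collected subtree C is the whole subtree under F.suc i.  An optimal S ending outside C
-- leaves C through i for a last time: S = A · (i↑) · B, where B stays outside C.  After A
-- all of C and all ancestors of C are filled, and the group still has at least w(i)
-- agents, hence enough for every edge.  Replace A by: the root path to C, an arbitrary
-- exploration X of C, i↑, the path back to the root, and A once more.  This walk visits
-- exactly the vertices that A fills, so, as group size plus settled weight is invariant,
-- it is feasible and ends with the same group and filled set as A; then i↑ · B runs as before.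
module Submission where

open import Defs
open import Data.Nat using (ℕ; zero; suc; _≤_; _<_; _+_; _∸_; z≤n; s≤s; _<?_)
open import Data.Nat.Properties
open import Data.Fin using (Fin; toℕ)
import Data.Fin as F
import Data.Fin.Properties as FP
open import Data.Fin.Induction using (<-wellFounded; >-wellFounded)
open import Data.Bool using (Bool; true; false; if_then_else_)
open import Data.Bool.Properties using (⇔→≡)
open import Data.List.Membership.Propositional using (_∈_)
open import Data.List.Relation.Unary.Any using (here; there)
open import Data.List.Relation.Unary.All using (All; []; _∷_)
import Data.List.Relation.Unary.All as All
open import Data.List.Relation.Unary.AllPairs using ([]; _∷_)
open import Data.List.Relation.Unary.Unique.Propositional using (Unique)
open import Data.Product using (Σ; ∃; _×_; _,_; proj₁; proj₂)
open import Data.Sum using (_⊎_; inj₁; inj₂)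
open import Data.Unit using (⊤; tt)
open import Data.Empty using (⊥; ⊥-elim)
open import Data.Vec.Functional using (Vector)
open import Algebra.Properties.CommutativeMonoid.Sum +-0-commutativeMonoid
  using (sum; sum-remove; sum-cong-≗)
open import Function using (_∘_; mk⇔)
open import Induction.WellFounded using (Acc; acc)
open import Relation.Nullary using (¬_; yes; no)
open import Relation.Binary.PropositionalEquality

sum-mono-≤ : ∀ {m} {f g : Vector ℕ m} → (∀ x → f x ≤ g x) → sum f ≤ sum g
sum-mono-≤ {zero}  f≤g = z≤n
sum-mono-≤ {suc m} f≤g = +-mono-≤ (f≤g F.zero) (sum-mono-≤ (f≤g ∘ F.suc))

module Deployment {n : ℕ} (T : Tree n) where
  open Tree T

  infix  4 _⊑_ _⊆_
  infixr 5 _++_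

  _⊑_ : V T → V T → Set
  _⊑_ = _≼_ T

  _++_ : ∀ {u v w} → Walk T u v → Walk T v w → Walk T u w
  _++_ = _++ʷ_ T

  ≼-trans : ∀ {u v w} → u ⊑ v → v ⊑ w → u ⊑ w
  ≼-trans p ≼-refl       = p
  ≼-trans p (≼-step j q) = ≼-step j (≼-trans p q)

  ≼-suc⁻ : ∀ {u j} → u ⊑ F.suc j → u ≡ F.suc j ⊎ u ⊑ par j
  ≼-suc⁻ ≼-refl       = inj₁ refl
  ≼-suc⁻ (≼-step _ p) = inj₂ p

  ≼-suc⇒≢root : ∀ {j v} → F.suc j ⊑ v → v ≢ F.zero
  ≼-suc⇒≢root () refl

  par<suc : ∀ j → par j F.< F.suc j
  par<suc j = s≤s (par< j)

  ≼⇒toℕ≤ : ∀ {u v} → u ⊑ v → toℕ u ≤ toℕ v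
  ≼⇒toℕ≤ ≼-refl       = ≤-refl
  ≼⇒toℕ≤ (≼-step j p) = ≤-trans (≼⇒toℕ≤ p) (<⇒≤ (par<suc j))

  suc⋢par : ∀ j → ¬ (F.suc j ⊑ par j)
  suc⋢par j p = <⇒≱ (par<suc j) (≼⇒toℕ≤ p)

  root≼ : ∀ v → F.zero ⊑ v
  root≼ v = go v (<-wellFounded v)
    where
    go : ∀ v → Acc F._<_ v → F.zero ⊑ v
    go F.zero    _        = ≼-refl
    go (F.suc j) (acc rs) = ≼-step j (go (par j) (rs (par<suc j)))

  ≼-total-below : ∀ {u v b} → u ⊑ b → v ⊑ b → u ⊑ v ⊎ v ⊑ u
  ≼-total-below ≼-refl       q             = inj₂ q
  ≼-total-below (≼-step j p) ≼-refl        = inj₁ (≼-step j p)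
  ≼-total-below (≼-step j p) (≼-step .j q) = ≼-total-below p q

  Childless : V T → Set
  Childless b = ∀ j → par j ≢ b

  leafBelow : ∀ v → ∃ λ b → v ⊑ b × Childless b
  leafBelow v = go v (>-wellFounded v)
    where
    go : ∀ v → Acc F._>_ v → ∃ λ b → v ⊑ b × Childless b
    go v (acc rs) with FP.any? (λ j → par j FP.≟ v)
    ... | no noChild = v , ≼-refl , λ j e → noChild (j , e)
    ... | yes (j , refl) with go (F.suc j) (rs (par<suc j))
    ...   | b , p , leaf = b , ≼-trans (≼-step j ≼-refl) p , leaf

  -- Dominating edges

  DominatesPath : Fin n → V T → Set
  DominatesPath d v =
    F.suc d ⊑ v × (∀ j → F.suc j ⊑ v → ew j ≤ ew d) ×
    (∀ j → F.suc j ⊑ v → ew j ≡ ew d → F.suc d ⊑ F.suc j)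

  DominatesPath-last : ∀ {x} → (∀ j → F.suc j ⊑ par x → ew j < ew x) → DominatesPath x (F.suc x)
  DominatesPath-last {x} lighter = ≼-refl , heaviest , nearest
    where
    heaviest : ∀ j → F.suc j ⊑ F.suc x → ew j ≤ ew x
    heaviest j q with ≼-suc⁻ q
    ... | inj₁ refl = ≤-refl
    ... | inj₂ q′   = <⇒≤ (lighter j q′)
    nearest : ∀ j → F.suc j ⊑ F.suc x → ew j ≡ ew x → F.suc x ⊑ F.suc j
    nearest j q eq with ≼-suc⁻ q
    ... | inj₁ refl = ≼-refl
    ... | inj₂ q′   = ⊥-elim (<-irrefl eq (lighter j q′))

  DominatesPath-step : ∀ {d x} → DominatesPath d (par x) → ew x ≤ ew d → DominatesPath d (F.suc x)
  DominatesPath-step {d} {x} (p , heaviest , nearest) x≤d = ≼-step x p , heaviest′ , nearest′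
    where
    heaviest′ : ∀ j → F.suc j ⊑ F.suc x → ew j ≤ ew d
    heaviest′ j q with ≼-suc⁻ q
    ... | inj₁ refl = x≤d
    ... | inj₂ q′   = heaviest j q′
    nearest′ : ∀ j → F.suc j ⊑ F.suc x → ew j ≡ ew d → F.suc d ⊑ F.suc j
    nearest′ j q eq with ≼-suc⁻ q
    ... | inj₁ refl = ≼-step x p
    ... | inj₂ q′   = nearest j q′ eq

  dominatorOf : ∀ {v} → F.zero ⊑ v → (∀ j → ¬ F.suc j ⊑ v) ⊎ ∃ λ d → DominatesPath d v
  dominatorOf ≼-refl = inj₁ λ j ()
  dominatorOf (≼-step x p) with dominatorOf p
  ... | inj₁ noEdge = inj₂ (x , DominatesPath-last λ j q → ⊥-elim (noEdge j q))
  ... | inj₂ (d , dom) with ew d <? ew x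
  ...   | yes d<x = inj₂ (x , DominatesPath-last λ j q → ≤-<-trans (proj₁ (proj₂ dom) j q) d<x)
  ...   | no  d≮x = inj₂ (d , DominatesPath-step dom (≮⇒≥ d≮x))

  leafDominator : ∀ {j b} → F.suc j ⊑ b → Childless b → ∃ λ d → Dominates T d b
  leafDominator {j} {b} p leaf with dominatorOf (root≼ b)
  ... | inj₁ noEdge    = ⊥-elim (noEdge j p)
  ... | inj₂ (d , dom) = d , (≼-suc⇒≢root p , leaf) , dom

  ++-assoc : ∀ {a b c d} (W₁ : Walk T a b) (W₂ : Walk T b c) (W₃ : Walk T c d) →
             (W₁ ++ W₂) ++ W₃ ≡ W₁ ++ (W₂ ++ W₃)
  ++-assoc stop       W₂ W₃ = refl
  ++-assoc (step a W) W₂ W₃ = cong (step a) (++-assoc W W₂ W₃)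

  ∈-verts-start : ∀ {u w} (W : Walk T u w) → u ∈ verts T W
  ∈-verts-start stop       = here refl
  ∈-verts-start (step a W) = here refl

  ∈-verts-++⁻ : ∀ {u v w} (W : Walk T u v) (W′ : Walk T v w) {x} →
                x ∈ verts T (W ++ W′) → x ∈ verts T W ⊎ x ∈ verts T W′
  ∈-verts-++⁻ stop       W′ m         = inj₂ m
  ∈-verts-++⁻ (step a W) W′ (here e)  = inj₁ (here e)
  ∈-verts-++⁻ (step a W) W′ (there m) with ∈-verts-++⁻ W W′ m
  ... | inj₁ m′ = inj₁ (there m′)
  ... | inj₂ m′ = inj₂ m′

  ∈-verts-++⁺ʳ : ∀ {u v w} (W : Walk T u v) {W′ : Walk T v w} {x} →
                 x ∈ verts T W′ → x ∈ verts T (W ++ W′)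
  ∈-verts-++⁺ʳ stop       m = m
  ∈-verts-++⁺ʳ (step a W) m = there (∈-verts-++⁺ʳ W m)

  walk-reaches : ∀ {u w y} (W : Walk T u w) → y ⊑ w → y ⊑ u ⊎ y ∈ verts T W
  walk-reaches stop p = inj₁ p
  walk-reaches (step (up j) W) p with walk-reaches W p
  ... | inj₁ q = inj₁ (≼-step j q)
  ... | inj₂ m = inj₂ (there m)
  walk-reaches (step (down j) W) p with walk-reaches W p
  ... | inj₂ m = inj₂ (there m)
  ... | inj₁ q with ≼-suc⁻ q
  ...   | inj₁ refl = inj₂ (there (∈-verts-start W))
  ...   | inj₂ q′   = inj₁ q′

  ancestor-∈-verts : ∀ {w y} (W : Walk T F.zero w) → y ⊑ w → y ∈ verts T W
  ancestor-∈-verts W p with walk-reaches W p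
  ... | inj₁ ≼-refl = ∈-verts-start W
  ... | inj₂ m      = m

  descend : ∀ {u v w} → u ⊑ v → Walk T v w → Walk T u w
  descend ≼-refl       W = W
  descend (≼-step j p) W = descend p (step (down j) W)

  descend-verts : ∀ {u v w} (p : u ⊑ v) (W : Walk T v w) {x} →
                  x ∈ verts T (descend p W) → x ⊑ v ⊎ x ∈ verts T W
  descend-verts ≼-refl       W m = inj₂ m
  descend-verts (≼-step j p) W m with descend-verts p (step (down j) W) m
  ... | inj₁ q          = inj₁ (≼-step j q)
  ... | inj₂ (here refl) = inj₁ (≼-step j ≼-refl)
  ... | inj₂ (there m′)  = inj₂ m′

  descend-unique : ∀ {u v w} (p : u ⊑ v) (W : Walk T v w) →
                   Unique (verts T W) → All (v ⊑_) (verts T W) → Unique (verts T (descend p W))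
  descend-unique ≼-refl       W unique below = unique
  descend-unique (≼-step j p) W unique below =
    descend-unique p (step (down j) W)
      (All.map (λ j⊑x par≡x → suc⋢par j (subst (F.suc j ⊑_) (sym par≡x) j⊑x)) below ∷ unique)
      (≼-refl ∷ All.map (≼-trans (≼-step j ≼-refl)) below)

  pathTo : ∀ v → Walk T F.zero v
  pathTo v = descend (root≼ v) stop

  pathTo-isPath : ∀ v → IsPath T (pathTo v)
  pathTo-isPath v = descend-unique (root≼ v) stop ([] ∷ []) (≼-refl ∷ [])

  pathTo-verts : ∀ v {x} → x ∈ verts T (pathTo v) → x ⊑ v
  pathTo-verts v m with descend-verts (root≼ v) stop m
  ... | inj₁ p          = p
  ... | inj₂ (here refl) = ≼-refl

  ascend : ∀ {u v} → u ⊑ v → Walk T v u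
  ascend ≼-refl       = stop
  ascend (≼-step j p) = step (up j) (ascend p)

  ascend-verts : ∀ {u v} (p : u ⊑ v) {x} → x ∈ verts T (ascend p) → x ⊑ v
  ascend-verts ≼-refl       (here refl) = ≼-refl
  ascend-verts (≼-step j p) (here refl) = ≼-refl
  ascend-verts (≼-step j p) (there m)   = ≼-step j (ascend-verts p m)

  _⊆_ : (V T → Bool) → (V T → Bool) → Set
  A ⊆ B = ∀ {x} → A x ≡ true → B x ≡ true

  ⊆-antisym : ∀ {A B} → A ⊆ B → B ⊆ A → A ≗ B
  ⊆-antisym A⊆B B⊆A x = ⇔→≡ {z = true} (mk⇔ A⊆B B⊆A)

  filled₀ : V T → Bool
  filled₀ = mark T F.zero (noneFilled T)

  mark-hit : ∀ v vis → mark T v vis v ≡ true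
  mark-hit v vis with v FP.≟ v
  ... | yes _   = refl
  ... | no v≢v = ⊥-elim (v≢v refl)

  filled₀-root : filled₀ F.zero ≡ true
  filled₀-root = mark-hit F.zero (noneFilled T)

  mark-other : ∀ {v x} vis → x ≢ v → mark T v vis x ≡ vis x
  mark-other {v} {x} vis x≢v with x FP.≟ v
  ... | yes x≡v = ⊥-elim (x≢v x≡v)
  ... | no _    = refl

  mark-⊇ : ∀ v vis → vis ⊆ mark T v vis
  mark-⊇ v vis {x} e with x FP.≟ v
  ... | yes _ = refl
  ... | no _  = e

  mark-⊆ : ∀ {v vis x} → mark T v vis x ≡ true → x ≡ v ⊎ vis x ≡ true
  mark-⊆ {v} {vis} {x} e with x FP.≟ v
  ... | yes x≡v = inj₁ x≡v
  ... | no _    = inj₂ e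

  mark-cong : ∀ v {vis vis′} → vis ≗ vis′ → mark T v vis ≗ mark T v vis′
  mark-cong v e x with x FP.≟ v
  ... | yes _ = refl
  ... | no _  = e x

  settle : (V T → Bool) → V T → V T → Bool
  settle vis v = if vis v then vis else mark T v vis

  settle-hit : ∀ vis v → settle vis v v ≡ true
  settle-hit vis v with vis v in filled
  ... | true  = filled
  ... | false = mark-hit v vis

  settle-⊇ : ∀ vis v → vis ⊆ settle vis v
  settle-⊇ vis v e with vis v
  ... | true  = e
  ... | false = mark-⊇ v vis e

  settle-⊆ : ∀ {vis v x} → settle vis v x ≡ true → x ≡ v ⊎ vis x ≡ true
  settle-⊆ {vis} {v} e with vis v
  ... | true  = inj₂ e
  ... | false = mark-⊆ {v} {vis} e

  settle-cong : ∀ v {vis vis′} → vis ≗ vis′ → settle vis v ≗ settle vis′ v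
  settle-cong v {vis} {vis′} e x with vis v | vis′ v | e v
  ... | true  | .true  | refl = e x
  ... | false | .false | refl = mark-cong v e x

  filledAfter-++ : ∀ {u v w} (W : Walk T u v) (W′ : Walk T v w) vis →
                   filledAfter T vis (W ++ W′) ≡ filledAfter T (filledAfter T vis W) W′
  filledAfter-++ stop               W′ vis = refl
  filledAfter-++ (step {v = v} a W) W′ vis = filledAfter-++ W W′ (settle vis v)

  filledAfter-⊇ : ∀ {u w} (W : Walk T u w) {vis} → vis ⊆ filledAfter T vis W
  filledAfter-⊇ stop               e = e
  filledAfter-⊇ (step {v = v} a W) {vis} e = filledAfter-⊇ W (settle-⊇ vis v e)

  filledAfter-verts : ∀ {u w} (W : Walk T u w) {vis x} → vis u ≡ true →
                      x ∈ verts T W → filledAfter T vis W x ≡ true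
  filledAfter-verts stop               start (here refl) = start
  filledAfter-verts (step a W) {vis} start (here refl) = filledAfter-⊇ (step a W) {vis} start
  filledAfter-verts (step {v = v} a W) {vis} start (there m) =
    filledAfter-verts W (settle-hit vis v) m

  filledAfter-⊆ : ∀ {u w} (W : Walk T u w) {vis x} →
                  filledAfter T vis W x ≡ true → vis x ≡ true ⊎ x ∈ verts T W
  filledAfter-⊆ stop e = inj₁ e
  filledAfter-⊆ (step {v = v} a W) {vis} {x} e with filledAfter-⊆ W e
  ... | inj₂ m = inj₂ (there m)
  ... | inj₁ e′ with settle-⊆ {vis} {v} {x} e′
  ...   | inj₁ refl = inj₂ (there (∈-verts-start W))
  ...   | inj₂ e″   = inj₁ e″

  filledAfter-cong : ∀ {u w} (W : Walk T u w) {vis vis′} → vis ≗ vis′ →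
                     filledAfter T vis W ≗ filledAfter T vis′ W
  filledAfter-cong stop               e = e
  filledAfter-cong (step {v = v} a W) e = filledAfter-cong W (settle-cong v e)

  -- Feasibility and the conservation of agents

  groupAfter : ∀ {u w} → ℕ → (V T → Bool) → Walk T u w → ℕ
  groupAfter g vis stop = g
  groupAfter g vis (step {v = v} a W) =
    if vis v then groupAfter g vis W else groupAfter (g ∸ vw v) (mark T v vis) W

  Feasible-cong : ∀ {u w} (W : Walk T u w) {g vis vis′} → vis ≗ vis′ →
                  Feasible T g vis W → Feasible T g vis′ W
  Feasible-cong stop               e _ = tt
  Feasible-cong (step {v = v} a W) {vis = vis} {vis′} e (edge , rest) with vis v | vis′ v | e v
  ... | true  | .true  | refl = edge , Feasible-cong W e rest
  ... | false | .false | refl = edge , proj₁ rest , Feasible-cong W (mark-cong v e) (proj₂ rest)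

  Feasible-++⁻ : ∀ {u v w} (W : Walk T u v) (W′ : Walk T v w) {g vis} →
                 Feasible T g vis (W ++ W′) →
                 Feasible T g vis W × Feasible T (groupAfter g vis W) (filledAfter T vis W) W′
  Feasible-++⁻ stop               W′ feas = tt , feas
  Feasible-++⁻ (step {v = v} a W) W′ {vis = vis} (edge , rest) with vis v
  ... | true  = let (feasW , feasW′) = Feasible-++⁻ W W′ rest in (edge , feasW) , feasW′
  ... | false = let (feasW , feasW′) = Feasible-++⁻ W W′ (proj₂ rest)
                in (edge , proj₁ rest , feasW) , feasW′

  Feasible-++⁺ : ∀ {u v w} (W : Walk T u v) (W′ : Walk T v w) {g vis} →
                 Feasible T g vis W → Feasible T (groupAfter g vis W) (filledAfter T vis W) W′ →
                 Feasible T g vis (W ++ W′)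
  Feasible-++⁺ stop               W′ _             feas′ = feas′
  Feasible-++⁺ (step {v = v} a W) W′ {vis = vis} (edge , rest) feas′ with vis v
  ... | true  = edge , Feasible-++⁺ W W′ rest feas′
  ... | false = edge , proj₁ rest , Feasible-++⁺ W W′ (proj₂ rest) feas′

  load : (V T → Bool) → V T → ℕ
  load vis x = if vis x then vw x else 0

  settled : (V T → Bool) → ℕ
  settled vis = sum (load vis)

  load-cong : ∀ vis vis′ x → vis x ≡ vis′ x → load vis x ≡ load vis′ x
  load-cong vis vis′ x = cong (λ b → if b then vw x else 0)

  settled-cong : ∀ {vis vis′} → vis ≗ vis′ → settled vis ≡ settled vis′
  settled-cong {vis} {vis′} e = sum-cong-≗ λ x → load-cong vis vis′ x (e x)

  settled-mono : ∀ {vis vis′} → vis ⊆ vis′ → settled vis ≤ settled vis′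
  settled-mono {vis} {vis′} vis⊆vis′ = sum-mono-≤ load≤
    where
    load≤ : ∀ x → load vis x ≤ load vis′ x
    load≤ x with vis x in filled
    ... | false = z≤n
    ... | true rewrite vis⊆vis′ filled = ≤-refl

  settled-mark : ∀ {v} vis → vis v ≡ false → settled (mark T v vis) ≡ vw v + settled vis
  settled-mark {v} vis unfilled = begin
    settled (mark T v vis)
      ≡⟨ sum-remove {i = v} (load (mark T v vis)) ⟩
    load (mark T v vis) v + sum (load (mark T v vis) ∘ F.punchIn v)
      ≡⟨ cong₂ _+_ (load-cong (mark T v vis) (λ _ → true) v (mark-hit v vis))
                   (sum-cong-≗ λ j → load-cong (mark T v vis) vis _ (mark-other vis (FP.punchInᵢ≢i v j))) ⟩
    vw v + sum (load vis ∘ F.punchIn v)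
      ≡⟨ cong (λ l → vw v + (l + sum (load vis ∘ F.punchIn v))) (sym (load-cong vis (λ _ → false) v unfilled)) ⟩
    vw v + (load vis v + sum (load vis ∘ F.punchIn v))
      ≡⟨ cong (vw v +_) (sym (sum-remove {i = v} (load vis))) ⟩
    vw v + settled vis
      ∎
    where
    open ≡-Reasoning

  settling-conserves : ∀ {g v} vis → vw v ≤ g → vis v ≡ false →
                       (g ∸ vw v) + settled (mark T v vis) ≡ g + settled vis
  settling-conserves {g} {v} vis vw≤g unfilled = begin
    (g ∸ vw v) + settled (mark T v vis) ≡⟨ cong ((g ∸ vw v) +_) (settled-mark vis unfilled) ⟩
    (g ∸ vw v) + (vw v + settled vis)   ≡⟨ sym (+-assoc (g ∸ vw v) (vw v) (settled vis)) ⟩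
    (g ∸ vw v) + vw v + settled vis     ≡⟨ cong (_+ settled vis) (m∸n+n≡m vw≤g) ⟩
    g + settled vis                     ∎
    where
    open ≡-Reasoning

  conservation : ∀ {u w} (W : Walk T u w) {g vis} → Feasible T g vis W →
                 groupAfter g vis W + settled (filledAfter T vis W) ≡ g + settled vis
  conservation stop               _ = refl
  conservation (step {v = v} a W) {vis = vis} (_ , rest) with vis v in filled
  ... | true  = conservation W rest
  ... | false = trans (conservation W (proj₂ rest)) (settling-conserves vis (proj₁ rest) filled)

  headroom : ∀ g s c z {x} → g + s ≡ c + z → x + s ≤ z → c + x ≤ g
  headroom g s c z {x} balance x+s≤z = +-cancelʳ-≤ s (c + x) g (begin
    c + x + s   ≡⟨ +-assoc c x s ⟩
    c + (x + s) ≤⟨ +-monoʳ-≤ c x+s≤z ⟩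
    c + z       ≡⟨ sym balance ⟩
    g + s       ∎)
    where
    open ≤-Reasoning

  group≥ : ∀ {g c} vis Z → g + settled vis ≡ c + settled Z → vis ⊆ Z → c ≤ g
  group≥ {g} {c} vis Z balance vis⊆Z =
    ≤-trans (m≤m+n c 0) (headroom g _ c _ balance (settled-mono {vis} {Z} vis⊆Z))

  -- The balance says the group exceeds c by exactly the weight still to be settled in Z,
  -- so it covers every edge and every settlement on the way.
  replay : ∀ (Z : V T → Bool) c → (∀ j → ew j ≤ c) →
           ∀ {u w} (W : Walk T u w) {g vis} → (∀ {x} → x ∈ verts T W → Z x ≡ true) →
           vis ⊆ Z → g + settled vis ≡ c + settled Z → Feasible T g vis W
  replay Z c light stop _ _ _ = tt
  replay Z c light (step {v = v} a W) {g} {vis} inZ vis⊆Z balance with vis v in filled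
  ... | true  = ≤-trans (light _) (group≥ vis Z balance vis⊆Z) ,
                replay Z c light W (inZ ∘ there) vis⊆Z balance
  ... | false = ≤-trans (light _) (group≥ vis Z balance vis⊆Z) , vw≤g ,
                replay Z c light W (inZ ∘ there) marked⊆Z (trans (settling-conserves vis vw≤g filled) balance)
    where
    marked⊆Z : mark T v vis ⊆ Z
    marked⊆Z e with mark-⊆ {v} {vis} e
    ... | inj₁ refl = inZ (there (∈-verts-start W))
    ... | inj₂ e′   = vis⊆Z e′
    vw≤g : vw v ≤ g
    vw≤g = ≤-trans (m≤n+m (vw v) c)
             (headroom g _ c _ balance
               (subst (_≤ settled Z) (settled-mark vis filled) (settled-mono {mark T v vis} {Z} marked⊆Z)))

  replay-prefix : ∀ {u v} (A W : Walk T u v) {g vis} → vis u ≡ true → Feasible T g vis A →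
                  (∀ j → ew j ≤ groupAfter g vis A) →
                  (∀ {x} → x ∈ verts T A → x ∈ verts T W) →
                  (∀ {x} → x ∈ verts T W → filledAfter T vis A x ≡ true) →
                  Feasible T g vis W × groupAfter g vis W ≡ groupAfter g vis A ×
                  filledAfter T vis W ≗ filledAfter T vis A
  replay-prefix A W {g} {vis} start feasA light A⊆W W⊆Z = feasW , sameGroup , sameFilled
    where
    Z  = filledAfter T vis A
    Z′ = filledAfter T vis W
    gA = groupAfter g vis A
    gW = groupAfter g vis W
    balance : g + settled vis ≡ gA + settled Z
    balance = sym (conservation A feasA)
    feasW : Feasible T g vis W
    feasW = replay Z gA light W W⊆Z (filledAfter-⊇ A {vis}) balance
    Z′⊆Z : Z′ ⊆ Z
    Z′⊆Z e with filledAfter-⊆ W {vis} e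
    ... | inj₁ e′ = filledAfter-⊇ A {vis} e′
    ... | inj₂ m  = W⊆Z m
    Z⊆Z′ : Z ⊆ Z′
    Z⊆Z′ e with filledAfter-⊆ A {vis} e
    ... | inj₁ e′ = filledAfter-⊇ W {vis} e′
    ... | inj₂ m  = filledAfter-verts W {vis} start (A⊆W m)
    sameFilled : Z′ ≗ Z
    sameFilled = ⊆-antisym Z′⊆Z Z⊆Z′
    sameGroup : gW ≡ gA
    sameGroup = +-cancelʳ-≡ (settled Z) gW gA (begin
      gW + settled Z  ≡⟨ cong (gW +_) (settled-cong (sym ∘ sameFilled)) ⟩
      gW + settled Z′ ≡⟨ conservation W feasW ⟩
      g + settled vis ≡⟨ balance ⟩
      gA + settled Z  ∎)
      where
      open ≡-Reasoning

  prefix-exchange : ∀ {u v w} (A W : Walk T u v) (S : Walk T v w) {g vis} →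
                    vis u ≡ true → Feasible T g vis (A ++ S) →
                    (∀ j → ew j ≤ groupAfter g vis A) →
                    (∀ {x} → x ∈ verts T A → x ∈ verts T W) →
                    (∀ {x} → x ∈ verts T W → filledAfter T vis A x ≡ true) →
                    Feasible T g vis (W ++ S) × filledAfter T vis (W ++ S) ≗ filledAfter T vis (A ++ S)
  prefix-exchange A W S {g} {vis} start feas light A⊆W W⊆Z = feas′ , sameFilledEnd
    where
    split = Feasible-++⁻ A S feas
    replayed = replay-prefix A W start (proj₁ split) light A⊆W W⊆Z
    sameGroup = proj₁ (proj₂ replayed)
    sameFilled = proj₂ (proj₂ replayed)
    feas′ : Feasible T g vis (W ++ S)
    feas′ = Feasible-++⁺ W S (proj₁ replayed)
              (subst (λ h → Feasible T h (filledAfter T vis W) S) (sym sameGroup)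
                (Feasible-cong S (sym ∘ sameFilled) (proj₂ split)))
    sameFilledEnd : filledAfter T vis (W ++ S) ≗ filledAfter T vis (A ++ S)
    sameFilledEnd x = begin
      filledAfter T vis (W ++ S) x                      ≡⟨ cong-app (filledAfter-++ W S vis) x ⟩
      filledAfter T (filledAfter T vis W) S x           ≡⟨ filledAfter-cong S sameFilled x ⟩
      filledAfter T (filledAfter T vis A) S x           ≡⟨ cong-app (filledAfter-++ A S vis) x ⟨
      filledAfter T vis (A ++ S) x                      ∎
      where
      open ≡-Reasoning

  -- Leaving a subtree

  Exits : Fin n → ∀ {u v} → Adj T u v → Set
  Exits i (up j)   = j ≡ i
  Exits i (down j) = ⊥

  NeverExits : Fin n → ∀ {u w} → Walk T u w → Set
  NeverExits i stop       = ⊤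
  NeverExits i (step a W) = ¬ Exits i a × NeverExits i W

  stays-below : ∀ {i u w} (W : Walk T u w) → NeverExits i W → F.suc i ⊑ u → F.suc i ⊑ w
  stays-below stop                 _           below = below
  stays-below (step (down j) W)    (_ , never) below = stays-below W never (≼-step j below)
  stays-below (step (up j) W)      (j≢i , never) below with ≼-suc⁻ below
  ... | inj₁ refl = ⊥-elim (j≢i refl)
  ... | inj₂ below′ = stays-below W never below′

  stays-outside : ∀ {i u w} (W : Walk T u w) → NeverExits i W → ¬ F.suc i ⊑ w →
                  ∀ {x} → x ∈ verts T W → ¬ F.suc i ⊑ x
  stays-outside stop       _     outside (here refl) = outside
  stays-outside (step a W) never outside (here refl) = outside ∘ stays-below (step a W) never
  stays-outside (step a W) never outside (there m)   = stays-outside W (proj₂ never) outside m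

  lastExit : ∀ i {u w} (W : Walk T u w) →
             NeverExits i W ⊎
             Σ (Walk T u (F.suc i)) λ A → Σ (Walk T (par i) w) λ B →
               W ≡ A ++ step (up i) B × NeverExits i B
  lastExit i stop = inj₁ tt
  lastExit i (step (up j) W) with lastExit i W | j FP.≟ i
  ... | inj₂ (A , B , refl , never) | _ = inj₂ (step (up j) A , B , refl , never)
  ... | inj₁ never | yes refl = inj₂ (stop , W , refl , never)
  ... | inj₁ never | no j≢i   = inj₁ (j≢i , never)
  lastExit i (step (down j) W) with lastExit i W
  ... | inj₂ (A , B , refl , never) = inj₂ (step (down j) A , B , refl , never)
  ... | inj₁ never = inj₁ ((λ ()) , never)

  must-exit : ∀ i {vt} (S : Walk T F.zero vt) → ¬ F.suc i ⊑ vt →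
              filledAfter T filled₀ S (F.suc i) ≡ true → ¬ NeverExits i S
  must-exit i S outside filled never with filledAfter-⊆ S {filled₀} filled
  ... | inj₂ m = stays-outside S never outside m ≼-refl
  ... | inj₁ e with mark-⊆ {F.zero} {noneFilled T} {F.suc i} e
  ...   | inj₁ ()
  ...   | inj₂ ()

  filled-before-exit : ∀ i {vt} (A : Walk T F.zero (F.suc i)) (B : Walk T (par i) vt) →
                       NeverExits i B → ¬ F.suc i ⊑ vt →
                       (∀ x → filledAfter T filled₀ (A ++ step (up i) B) x ≡ true) →
                       ∀ {y} → y ⊑ F.suc i ⊎ F.suc i ⊑ y → filledAfter T filled₀ A y ≡ true
  filled-before-exit i A B never outside allFilled (inj₁ y⊑i) =
    filledAfter-verts A filled₀-root (ancestor-∈-verts A y⊑i)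
  filled-before-exit i A B never outside allFilled {y} (inj₂ i⊑y)
    with filledAfter-⊆ (step (up i) B) {filledAfter T filled₀ A}
           (trans (sym (cong-app (filledAfter-++ A (step (up i) B) filled₀) y)) (allFilled y))
  ... | inj₁ e           = e
  ... | inj₂ (here refl) = filled-before-exit i A B never outside allFilled (inj₁ ≼-refl)
  ... | inj₂ (there m)   = ⊥-elim (stays-outside B never outside m i⊑y)

  module HeaviestDominator (i : Fin n) (dom : DominatesCollected T i)
                           (heaviest : ∀ j → DominatesCollected T j → ew j ≤ ew i) where

    -- Every edge lies above some leaf, whose dominating edge is at most as heavy as i.
    ew≤ew-i : ∀ f → ew f ≤ ew i
    ew≤ew-i f with leafBelow (F.suc f)
    ... | b , f⊑b , leaf with leafDominator f⊑b leaf
    ...   | d , d-dom@(_ , _ , maxD , _) = ≤-trans (maxD f f⊑b) (heaviest d (b , d-dom))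

    subtree⊆C : ∀ {y} → F.suc i ⊑ y → InC T i y
    subtree⊆C {y} i⊑y with leafBelow y
    ... | b , y⊑b , leaf =
      b , ((≼-suc⇒≢root i⊑b , leaf) , i⊑b , (λ j _ → ew≤ew-i j) , nearest) , i⊑y , y⊑b
      where
      i⊑b = ≼-trans i⊑y y⊑b
      -- An equally heavy edge above i also lies on the path to the leaf i is known to dominate.
      nearest : ∀ j → F.suc j ⊑ b → ew j ≡ ew i → F.suc i ⊑ F.suc j
      nearest j j⊑b eq with ≼-total-below j⊑b i⊑b
      ... | inj₁ j⊑i = let (_ , _ , i⊑b₀ , _ , nearest₀) = dom in nearest₀ j (≼-trans j⊑i i⊑b₀) eq
      ... | inj₂ i⊑j = i⊑j

    exchange : ∀ k {vt} (A : Walk T F.zero (F.suc i)) (B : Walk T (par i) vt) →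
               NeverExits i B → ¬ F.suc i ⊑ vt → Valid T k (A ++ step (up i) B) →
               (X : Walk T (F.suc i) (F.suc i)) → All (InC T i) (verts T X) →
               Valid T k (pathTo (F.suc i) ++ (X ++ step (up i) (ascend (root≼ (par i)) ++ (A ++ step (up i) B))))
    exchange k A B never outside (k≥ , feas , allFilled) X X⊆C =
      subst (Valid T k) regroup (k≥ , proj₁ exchanged , λ x → trans (proj₂ exchanged x) (allFilled x))
      where
      P    = pathTo (F.suc i)
      Q    = ascend (root≼ (par i))
      Exit = step (up i) B
      W    = P ++ (X ++ step (up i) (Q ++ A))
      Z    = filledAfter T filled₀ A
      ancestor-filled : ∀ {y} → y ⊑ F.suc i → Z y ≡ true
      ancestor-filled = filled-before-exit i A B never outside allFilled ∘ inj₁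
      descendant-filled : ∀ {y} → F.suc i ⊑ y → Z y ≡ true
      descendant-filled = filled-before-exit i A B never outside allFilled ∘ inj₂
      W⊆Z : ∀ {x} → x ∈ verts T W → Z x ≡ true
      W⊆Z m with ∈-verts-++⁻ P _ m
      ... | inj₁ mP = ancestor-filled (pathTo-verts (F.suc i) mP)
      ... | inj₂ m′ with ∈-verts-++⁻ X _ m′
      ...   | inj₁ mX with All.lookup X⊆C mX
      ...     | _ , _ , i⊑x , _ = descendant-filled i⊑x
      W⊆Z m | inj₂ m′ | inj₂ (here refl) = ancestor-filled ≼-refl
      W⊆Z m | inj₂ m′ | inj₂ (there m″) with ∈-verts-++⁻ Q A m″
      ...   | inj₁ mQ = ancestor-filled (≼-step i (ascend-verts (root≼ (par i)) mQ))
      ...   | inj₂ mA = filledAfter-verts A filled₀-root mA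
      light : ∀ j → ew j ≤ groupAfter (k ∸ vw F.zero) filled₀ A
      light j = ≤-trans (ew≤ew-i j) (proj₁ (proj₂ (Feasible-++⁻ A Exit feas)))
      exchanged : Feasible T (k ∸ vw F.zero) filled₀ (W ++ Exit) ×
                  filledAfter T filled₀ (W ++ Exit) ≗ filledAfter T filled₀ (A ++ Exit)
      exchanged = prefix-exchange A W Exit filled₀-root feas light
                    (∈-verts-++⁺ʳ P ∘ ∈-verts-++⁺ʳ X ∘ there ∘ ∈-verts-++⁺ʳ Q) W⊆Z
      regroup : W ++ Exit ≡ P ++ (X ++ step (up i) (Q ++ (A ++ Exit)))
      regroup = begin
        (P ++ (X ++ step (up i) (Q ++ A))) ++ Exit ≡⟨ ++-assoc P _ Exit ⟩
        P ++ ((X ++ step (up i) (Q ++ A)) ++ Exit) ≡⟨ cong (P ++_) (++-assoc X _ Exit) ⟩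
        P ++ (X ++ step (up i) ((Q ++ A) ++ Exit)) ≡⟨ cong (λ R → P ++ (X ++ step (up i) R)) (++-assoc Q A Exit) ⟩
        P ++ (X ++ step (up i) (Q ++ (A ++ Exit))) ∎
        where
        open ≡-Reasoning

    reorganise : ∀ k {vt} (S : Walk T F.zero vt) → Valid T k S → ¬ F.suc i ⊑ vt →
                 (X : Walk T (F.suc i) (F.suc i)) → All (InC T i) (verts T X) →
                 Valid T k (pathTo (F.suc i) ++ (X ++ step (up i) (ascend (root≼ (par i)) ++ S)))
    reorganise k S valid outside X X⊆C with lastExit i S
    ... | inj₁ never = ⊥-elim (must-exit i S outside (proj₂ (proj₂ valid) (F.suc i)) never)
    ... | inj₂ (A , B , refl , never) = exchange k A B never outside valid X X⊆C

lemma7 : ∀ {n} (T : Tree n) (i : Fin n)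
         → DominatesCollected T i
         → (∀ j → DominatesCollected T j → Tree.ew T j ≤ Tree.ew T i)
         → (k : ℕ) (vt : Fin (ℕ.suc n)) (S : Walk T (vs T) vt)
         → Optimal T k S
         → ¬ InC T i vt
         → Σ (Walk T (vs T) (F.suc i)) λ P → IsPath T P ×
           Σ (Walk T (Tree.par T i) vt) λ R →
             ∀ (X : Walk T (F.suc i) (F.suc i)) → Explores T i X
             → Valid T k (_++ʷ_ T P (_++ʷ_ T X (step (up i) R)))
lemma7 T i dom heaviest k vt S (valid , _) vt∉C =
  pathTo (F.suc i) , pathTo-isPath (F.suc i) , ascend (root≼ (Tree.par T i)) ++ S ,
  λ X (X⊆C , _) → reorganise k S valid (vt∉C ∘ subtree⊆C) X X⊆C
  where
  open Deployment T
  open HeaviestDominator i dom heaviest
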